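{- Let $k,n\ge1$, let $\mathcal D$ be a $(1,k)$-Dyck path of size $n$, and let $\mathcal X=(\mathbf x_1,\dots,\mathbf x_{n+1})$ be constructed from $\mathcal D$ as in the context. Then the directed graph $\mathtt{For}(\mathcal X)$ is a planar rooted tree, in the following sense: 1. it consists of a single connected component; 2. there is no outgoing edge from the vertex $\mathbf x_1$, which is the root; 3. for every $2\le i\le n+1$ there is a unique directed path from $\mathbf x_i$ to $\mathbf x_1$.
   Context: Lattice paths use $U=(0,1)$ and $D=(1,0)$. A $(1,k)$-Dyck path of size $n$ is a path from $(0,0)$ to $(kn,n)$ whose $i$-th up step is preceded by at least $k(i-1)$ right steps, i.e. weakly below $(UD^k)^n$. **Step sequences.** The step sequence is $\mathfrak m(\mathcal D)=(m_1,\dots,m_{n+1})$, where $m_i=kn-\alpha_i$ if the $i$-th up step lies on the line $x=\alpha_i$, and $m_{n+1}=0$. Put $\mathfrak m:=\mathfrak m(\mathcal D)$. For $i=k,k-1,\dots,1$ in turn, set $\mathfrak m(D_i):=\lceil\mathfrak m/i\rceil$ componentwise and replace $\mathfrak m$ by $\mathfrak m-\mathfrak m(D_i)$. Write $\mathfrak m(D_i)=(M_{i,1},\dots,M_{i,n+1})$. **The tuple $\mathcal X$.** Put $x_{i,j}:=j-M_{i,n+2-j}$ for $1\le i\le k$, $1\le j\le n+1$, and $\mathbf x_j:=(x_{1,j},\dots,x_{k,j})$. Thus $\mathbf x_1=(1,\dots,1)$. **The graph.** Two vectors $\mathbf x,\mathbf y\in\mathbb Z^k$ are adjacent if $|x_i-y_i|\le1$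 for all $i$. $\mathtt{For}(\mathcal X)$ is the directed graph on the vertices $\mathbf x_1,\dots,\mathbf x_{n+1}$, indexed by position. For each $i\ge2$, if some $j<i$ has $\mathbf x_j$ adjacent to $\mathbf x_i$, take the largest such $j$ and draw the edge $\mathbf x_i\to\mathbf x_j$. -}

module Defs where

open import Data.Nat using (ℕ; zero; suc; _+_; _*_; _∸_; _≤_; _<_; _≟_; _/_)
open import Data.Integer as ℤ using (ℤ; +_; ∣_∣)
open import Data.List using (List; []; _∷_)
open import Data.Fin using (Fin; toℕ)
open import Data.Product using (_×_; ∃)
open import Data.Sum using (_⊎_)
open import Data.Unit using (⊤)
open import Data.Empty using (⊥)
open import Relation.Nullary using (¬_; yes; no)
open import Relation.Binary.PropositionalEquality using (_≡_)

-- Lattice paths: U = (0,1) (up), D = (1,0) (right)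

data Step : Set where
  U D : Step

countU : List Step → ℕ
countU []      = 0
countU (U ∷ p) = suc (countU p)
countU (D ∷ p) = countU p

countD : List Step → ℕ
countD []      = 0
countD (U ∷ p) = countD p
countD (D ∷ p) = suc (countD p)

Below : ℕ → ℕ → ℕ → List Step → Set
Below k u d []      = ⊤
Below k u d (U ∷ p) = (k * u ≤ d) × Below k (suc u) d p
Below k u d (D ∷ p) = Below k u (suc d) p

IsDyck : ℕ → ℕ → List Step → Set
IsDyck k n p = (countU p ≡ n) × (countD p ≡ k * n) × Below k 0 0 p

-- alphaFrom d p i : the x-coordinate of the i-th (1-indexed) up step of p,
-- when d right steps have already been taken (0 if out of range).
alphaFrom : ℕ → List Step → ℕ → ℕ
alphaFrom d []      i             = 0
alphaFrom d (D ∷ p) i             = alphaFrom (suc d) p i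
alphaFrom d (U ∷ p) zero          = 0
alphaFrom d (U ∷ p) (suc zero)    = d
alphaFrom d (U ∷ p) (suc (suc i)) = alphaFrom d p (suc i)

alpha : List Step → ℕ → ℕ
alpha p i = alphaFrom 0 p i

stepSeq : ℕ → ℕ → List Step → ℕ → ℕ
stepSeq k n p i with i Data.Nat.≤? n
... | yes _ = k * n ∸ alpha p i
... | no  _ = 0

ceilDivSuc : ℕ → ℕ → ℕ
ceilDivSuc a t = (a + t) / suc t

-- Mdec t m i c : the c-th component of m(D_i), when the decomposition
-- runs i = t, t-1, …, 1 starting from the sequence m.
-- (Each stage: m(D_i) = ⌈m / i⌉ componentwise, m := m - m(D_i).)
Mdec : ℕ → (ℕ → ℕ) → ℕ → ℕ → ℕ
Mdec zero    m i c = 0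
Mdec (suc t) m i c with i ≟ suc t
... | yes _ = ceilDivSuc (m c) t
... | no  _ = Mdec t (λ c' → m c' ∸ ceilDivSuc (m c') t) i c

Mcomp : ℕ → ℕ → List Step → ℕ → ℕ → ℕ
Mcomp k n p i c = Mdec k (stepSeq k n p) i c

xcoord : ℕ → ℕ → List Step → ℕ → ℕ → ℤ
xcoord k n p i j = (+ j) ℤ.- (+ Mcomp k n p i ((2 + n) ∸ j))

xvec : (k n : ℕ) → List Step → ℕ → Fin k → ℤ
xvec k n p j r = xcoord k n p (suc (toℕ r)) j

Adjacent : {k : ℕ} → (Fin k → ℤ) → (Fin k → ℤ) → Set
Adjacent x y = ∀ r → ∣ x r ℤ.- y r ∣ ≤ 1

Edge : (k n : ℕ) → List Step → ℕ → ℕ → Set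
Edge k n p i j =
  (2 ≤ i) × (i ≤ suc n) × (1 ≤ j) × (j < i) ×
  Adjacent (xvec k n p j) (xvec k n p i) ×
  (∀ j' → j < j' → j' < i → ¬ Adjacent (xvec k n p j') (xvec k n p i))

DirPath : (k n : ℕ) → List Step → ℕ → ℕ → List ℕ → Set
DirPath k n p a b []            = ⊥
DirPath k n p a b (v ∷ [])      = (v ≡ a) × (v ≡ b)
DirPath k n p a b (v ∷ w ∷ vs)  = (v ≡ a) × Edge k n p v w × DirPath k n p w b (w ∷ vs)

UWalk : (k n : ℕ) → List Step → ℕ → ℕ → List ℕ → Set
UWalk k n p a b []            = ⊥
UWalk k n p a b (v ∷ [])      = (v ≡ a) × (v ≡ b)
UWalk k n p a b (v ∷ w ∷ vs)  =
  (v ≡ a) × (Edge k n p v w ⊎ Edge k n p w v) × UWalk k n p w b (w ∷ vs)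

{-# OPTIONS --safe #-}
module Submission where

-- Every x_j with j ≥ 2 has an adjacent predecessor; then each x_i (i ≥ 2) has exactly one
-- outgoing edge, pointing to a smaller index, and x_1 has none, so following edges from any
-- vertex reaches x_1 along a unique path.
--
-- For the predecessor, write μ_j = m_{n+2-j} and P_i(a) = part k i a for the i-th part of the
-- ceiling decomposition of a single number a, so that x_{i,j} = j - P_i(μ_j).  Each P_i is monotone
-- with P_i(a + k) = P_i(a) + 1, hence x_t and x_j are adjacent as soon as
-- μ_j ≤ μ_t + k(j - t) ≤ μ_j + k.  Since μ is monotone, s ↦ μ_s + k(j - s) drops by at most
-- k per step; it is ≥ μ_j at s = 1 (the Dyck condition gives μ_j ≤ k(j - 1)) and equals μ_j
-- at s = j, so it enters the window [μ_j, μ_j + k] at some t < j.  The window does not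
-- depend on i, so this one t serves all k coordinates at once.

open import Defs
open import Data.Nat
  using (ℕ; zero; suc; _+_; _*_; _∸_; _≤_; _<_; _≟_; _≤?_; z≤n; s≤s; _/_)
open import Data.Nat.Properties
open import Data.Nat.DivMod using (/-monoˡ-≤; m/n≡1+[m∸n]/n; m<n⇒m/n≡0)
open import Data.Nat.Induction using (<-wellFounded)
open import Data.Integer as ℤ using (ℤ; +_; _⊖_)
open import Data.Integer.Properties using (pos-+; [+m]-[+n]≡m⊖n; ∣⊖∣-≤)
open import Data.Integer.Tactic.RingSolver using (solve-∀)
open import Data.Fin using (Fin; toℕ)
open import Data.Fin.Properties using (toℕ<n; all?)
open import Data.List using (List; []; _∷_; _++_)
open import Data.Product using (_×_; _,_; ∃)
open import Data.Sum using (inj₁; inj₂; swap)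
open import Induction.WellFounded using (Acc; acc)
open import Relation.Nullary using (¬_; yes; no; Dec; contradiction)
open import Relation.Unary using (Decidable)
open import Relation.Binary.Definitions using (tri<; tri≈; tri>)
open import Relation.Binary.PropositionalEquality
  using (_≡_; refl; sym; trans; cong; subst; module ≡-Reasoning)

ceilDivSuc-mono-≤ : ∀ t {a b} → a ≤ b → ceilDivSuc a t ≤ ceilDivSuc b t
ceilDivSuc-mono-≤ t a≤b = /-monoˡ-≤ (suc t) (+-monoˡ-≤ t a≤b)

ceilDivSuc-suc+ : ∀ t a → ceilDivSuc (suc t + a) t ≡ suc (ceilDivSuc a t)
ceilDivSuc-suc+ t a = begin
  (suc t + a + t) / suc t                  ≡⟨ cong (_/ suc t) (+-assoc (suc t) a t) ⟩
  (suc t + (a + t)) / suc t                ≡⟨ m/n≡1+[m∸n]/n (m≤m+n (suc t) (a + t)) ⟩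
  suc ((suc t + (a + t) ∸ suc t) / suc t)  ≡⟨ cong (λ z → suc (z / suc t)) (m+n∸m≡n (suc t) _) ⟩
  suc ((a + t) / suc t)                    ∎
  where open ≡-Reasoning

ceilDivSuc-suc-≤ : ∀ t a → ceilDivSuc (suc a) t ≤ suc (ceilDivSuc a t)
ceilDivSuc-suc-≤ t a = begin
  ceilDivSuc (suc a) t      ≤⟨ ceilDivSuc-mono-≤ t (s≤s (m≤n+m a t)) ⟩
  ceilDivSuc (suc t + a) t  ≡⟨ ceilDivSuc-suc+ t a ⟩
  suc (ceilDivSuc a t)      ∎
  where open ≤-Reasoning

ceilDivSuc-≤ : ∀ t a → ceilDivSuc a t ≤ a
ceilDivSuc-≤ t zero    = ≤-reflexive (m<n⇒m/n≡0 (n<1+n t))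
ceilDivSuc-≤ t (suc a) = ≤-trans (ceilDivSuc-suc-≤ t a) (s≤s (ceilDivSuc-≤ t a))

rest : ℕ → ℕ → ℕ
rest t a = a ∸ ceilDivSuc a t

rest-suc+ : ∀ t a → rest t (suc t + a) ≡ t + rest t a
rest-suc+ t a = begin
  suc t + a ∸ ceilDivSuc (suc t + a) t ≡⟨ cong (suc t + a ∸_) (ceilDivSuc-suc+ t a) ⟩
  t + a ∸ ceilDivSuc a t               ≡⟨ +-∸-assoc t (ceilDivSuc-≤ t a) ⟩
  t + rest t a                         ∎
  where open ≡-Reasoning

step-mono⇒mono-≤ : (f : ℕ → ℕ) → (∀ a → f a ≤ f (suc a)) → ∀ {a b} → a ≤ b → f a ≤ f b
step-mono⇒mono-≤ f step {b = zero}  z≤n    = ≤-refl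
step-mono⇒mono-≤ f step {b = suc b} a≤1+b with m≤n⇒m<n∨m≡n a≤1+b
... | inj₁ (s≤s a≤b) = ≤-trans (step-mono⇒mono-≤ f step a≤b) (step b)
... | inj₂ refl      = ≤-refl

rest-mono-≤ : ∀ t {a b} → a ≤ b → rest t a ≤ rest t b
rest-mono-≤ t = step-mono⇒mono-≤ (rest t) (λ a → ∸-monoʳ-≤ (suc a) (ceilDivSuc-suc-≤ t a))

part : ℕ → ℕ → ℕ → ℕ
part zero    i a = 0
part (suc t) i a with i ≟ suc t
... | yes _ = ceilDivSuc a t
... | no  _ = part t i (rest t a)

Mdec≡part : ∀ t m i c → Mdec t m i c ≡ part t i (m c)
Mdec≡part zero    m i c = refl
Mdec≡part (suc t) m i c with i ≟ suc t
... | yes _ = refl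
... | no  _ = Mdec≡part t (λ c′ → m c′ ∸ ceilDivSuc (m c′) t) i c

part-mono-≤ : ∀ t i {a b} → a ≤ b → part t i a ≤ part t i b
part-mono-≤ zero    i a≤b = z≤n
part-mono-≤ (suc t) i a≤b with i ≟ suc t
... | yes _ = ceilDivSuc-mono-≤ t a≤b
... | no  _ = part-mono-≤ t i (rest-mono-≤ t a≤b)

part-+ : ∀ t i → 1 ≤ i → i ≤ t → ∀ a → part t i (t + a) ≡ suc (part t i a)
part-+ zero    i (s≤s _) () a
part-+ (suc t) i 1≤i i≤1+t a with i ≟ suc t
... | yes _   = ceilDivSuc-suc+ t a
... | no  i≢t = trans (cong (part t i) (rest-suc+ t a))
                      (part-+ t i 1≤i (≤-pred (≤∧≢⇒< i≤1+t i≢t)) (rest t a))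

part-*-+ : ∀ t i → 1 ≤ i → i ≤ t → ∀ d a → part t i (t * d + a) ≡ d + part t i a
part-*-+ t i 1≤i i≤t zero    a = cong (λ z → part t i (z + a)) (*-zeroʳ t)
part-*-+ t i 1≤i i≤t (suc d) a = begin
  part t i (t * suc d + a)   ≡⟨ cong (λ z → part t i (z + a)) (*-suc t d) ⟩
  part t i (t + t * d + a)   ≡⟨ cong (part t i) (+-assoc t (t * d) a) ⟩
  part t i (t + (t * d + a)) ≡⟨ part-+ t i 1≤i i≤t (t * d + a) ⟩
  suc (part t i (t * d + a)) ≡⟨ cong suc (part-*-+ t i 1≤i i≤t d a) ⟩
  suc (d + part t i a)       ∎
  where open ≡-Reasoning

alphaFrom-zero : ∀ d p → alphaFrom d p 0 ≡ 0
alphaFrom-zero d []      = refl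
alphaFrom-zero d (U ∷ p) = refl
alphaFrom-zero d (D ∷ p) = alphaFrom-zero (suc d) p

start≤alphaFrom : ∀ d p i → suc i ≤ countU p → d ≤ alphaFrom d p (suc i)
start≤alphaFrom d (D ∷ p) i       le = ≤-trans (n≤1+n d) (start≤alphaFrom (suc d) p i le)
start≤alphaFrom d (U ∷ p) zero    le = ≤-refl
start≤alphaFrom d (U ∷ p) (suc i) le = start≤alphaFrom d p i (≤-pred le)

alphaFrom-mono : ∀ d p i → suc i ≤ countU p → alphaFrom d p i ≤ alphaFrom d p (suc i)
alphaFrom-mono d p       zero          _  = ≤-trans (≤-reflexive (alphaFrom-zero d p)) z≤n
alphaFrom-mono d (D ∷ p) (suc i)       le = alphaFrom-mono (suc d) p (suc i) le
alphaFrom-mono d (U ∷ p) (suc zero)    le = start≤alphaFrom d p 0 (≤-pred le)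
alphaFrom-mono d (U ∷ p) (suc (suc i)) le = alphaFrom-mono d p (suc i) (≤-pred le)

Below⇒k*≤alphaFrom : ∀ {k u d} p → Below k u d p →
  ∀ i → suc i ≤ countU p → k * (u + i) ≤ alphaFrom d p (suc i)
Below⇒k*≤alphaFrom (D ∷ p) below i le = Below⇒k*≤alphaFrom p below i le
Below⇒k*≤alphaFrom {k} {u} {d} (U ∷ p) (ku≤d , below) zero le =
  subst (λ z → k * z ≤ d) (sym (+-identityʳ u)) ku≤d
Below⇒k*≤alphaFrom {k} {u} {d} (U ∷ p) (ku≤d , below) (suc i) le =
  subst (λ z → k * z ≤ alphaFrom d p (suc i)) (sym (+-suc u i))
        (Below⇒k*≤alphaFrom p below i (≤-pred le))

stepSeq-≤ : ∀ {k n} p {c} → c ≤ n → stepSeq k n p c ≡ k * n ∸ alpha p c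
stepSeq-≤ {n = n} p {c} c≤n with c ≤? n
... | yes _   = refl
... | no  c≰n = contradiction c≤n c≰n

stepSeq-≰ : ∀ {k n} p {c} → ¬ c ≤ n → stepSeq k n p c ≡ 0
stepSeq-≰ {n = n} p {c} c≰n with c ≤? n
... | yes c≤n = contradiction c≤n c≰n
... | no  _   = refl

stepSeq-antitone : ∀ {k n p} → countU p ≡ n → ∀ c → stepSeq k n p (suc c) ≤ stepSeq k n p c
stepSeq-antitone {k} {n} {p} countU≡n c = by-cases (suc c ≤? n)
  where
  open ≤-Reasoning
  ups : suc c ≤ n → suc c ≤ countU p
  ups = subst (suc c ≤_) (sym countU≡n)
  by-cases : Dec (suc c ≤ n) → stepSeq k n p (suc c) ≤ stepSeq k n p c
  by-cases (no  c≮n) = ≤-trans (≤-reflexive (stepSeq-≰ p c≮n)) z≤n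
  by-cases (yes c<n) = begin
    stepSeq k n p (suc c)     ≡⟨ stepSeq-≤ p c<n ⟩
    k * n ∸ alpha p (suc c)   ≤⟨ ∸-monoʳ-≤ (k * n) (alphaFrom-mono 0 p c (ups c<n)) ⟩
    k * n ∸ alpha p c         ≡⟨ stepSeq-≤ p (<⇒≤ c<n) ⟨
    stepSeq k n p c           ∎

stepSeq-suc-≤ : ∀ {k n p} → IsDyck k n p → ∀ c → stepSeq k n p (suc c) ≤ k * (n ∸ c)
stepSeq-suc-≤ {k} {n} {p} (countU≡n , _ , below) c = by-cases (suc c ≤? n)
  where
  open ≤-Reasoning
  ups : suc c ≤ n → suc c ≤ countU p
  ups = subst (suc c ≤_) (sym countU≡n)
  by-cases : Dec (suc c ≤ n) → stepSeq k n p (suc c) ≤ k * (n ∸ c)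
  by-cases (no  c≮n) = ≤-trans (≤-reflexive (stepSeq-≰ p c≮n)) z≤n
  by-cases (yes c<n) = begin
    stepSeq k n p (suc c)     ≡⟨ stepSeq-≤ p c<n ⟩
    k * n ∸ alpha p (suc c)   ≤⟨ ∸-monoʳ-≤ (k * n) (Below⇒k*≤alphaFrom p below c (ups c<n)) ⟩
    k * n ∸ k * c             ≡⟨ *-distribˡ-∸ k n c ⟨
    k * (n ∸ c)               ∎

-- The last t < b with c ≤ f t works, because f (suc t) ≤ c.
window-crossing : ∀ (f : ℕ → ℕ) {k c a b} → a < b → c ≤ f a → f b ≤ c →
  (∀ s → a ≤ s → s < b → f s ≤ k + f (suc s)) →
  ∃ λ t → a ≤ t × t < b × c ≤ f t × f t ≤ k + c
window-crossing f {k} {c} {a} {suc b} (s≤s a≤b) c≤fa fb≤c drop with c ≤? f b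
... | yes c≤fb = b , a≤b , ≤-refl , c≤fb , ≤-trans (drop b a≤b ≤-refl) (+-monoʳ-≤ k fb≤c)
... | no  c≰fb with m≤n⇒m<n∨m≡n a≤b
...   | inj₂ refl = contradiction c≤fa c≰fb
...   | inj₁ a<b  with window-crossing f a<b c≤fa (<⇒≤ (≰⇒> c≰fb))
                         (λ s a≤s s<b → drop s a≤s (m<n⇒m<1+n s<b))
...     | t , a≤t , t<b , in-window = t , a≤t , m<n⇒m<1+n t<b , in-window

∣[t-a]-[j-b]∣≤1 : ∀ {t j a b} → t ≤ j → b ≤ (j ∸ t) + a → (j ∸ t) + a ≤ suc b →
  ℤ.∣ (+ t ℤ.- + a) ℤ.- (+ j ℤ.- + b) ∣ ≤ 1
∣[t-a]-[j-b]∣≤1 {t} {j} {a} {b} t≤j lo hi =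
  subst (λ z → ℤ.∣ z ∣ ≤ 1) (sym difference)
    (subst (_≤ 1) (sym (∣⊖∣-≤ lo))
      (m≤n+o⇒m∸n≤o ((j ∸ t) + a) b (subst ((j ∸ t) + a ≤_) (+-comm 1 b) hi)))
  where
  open ≡-Reasoning
  rearrange : ∀ (t a d b : ℤ) → (t ℤ.- a) ℤ.- ((t ℤ.+ d) ℤ.- b) ≡ b ℤ.- (d ℤ.+ a)
  rearrange = solve-∀
  difference : (+ t ℤ.- + a) ℤ.- (+ j ℤ.- + b) ≡ b ⊖ ((j ∸ t) + a)
  difference = begin
    (+ t ℤ.- + a) ℤ.- (+ j ℤ.- + b)
      ≡⟨ cong (λ z → (+ t ℤ.- + a) ℤ.- (z ℤ.- + b))
              (trans (cong +_ (sym (m+[n∸m]≡n t≤j))) (pos-+ t (j ∸ t))) ⟩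
    (+ t ℤ.- + a) ℤ.- ((+ t ℤ.+ + (j ∸ t)) ℤ.- + b)
      ≡⟨ rearrange (+ t) (+ a) (+ (j ∸ t)) (+ b) ⟩
    + b ℤ.- (+ (j ∸ t) ℤ.+ + a)
      ≡⟨ cong (λ z → + b ℤ.- z) (sym (pos-+ (j ∸ t) a)) ⟩
    + b ℤ.- + ((j ∸ t) + a)
      ≡⟨ [+m]-[+n]≡m⊖n b ((j ∸ t) + a) ⟩
    b ⊖ ((j ∸ t) + a) ∎

HasEarlierNeighbours : ℕ → ℕ → List Step → Set
HasEarlierNeighbours k n p =
  ∀ j → 2 ≤ j → j ≤ suc n → ∃ λ t → 1 ≤ t × t < j × Adjacent (xvec k n p t) (xvec k n p j)

module Coordinates (k n : ℕ) (p : List Step) where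

  μ : ℕ → ℕ
  μ j = stepSeq k n p ((2 + n) ∸ j)

  μ-mono-suc : countU p ≡ n → ∀ {s} → s ≤ suc n → μ s ≤ μ (suc s)
  μ-mono-suc countU≡n {s} s≤1+n = begin
    μ s                              ≡⟨ cong (stepSeq k n p) (+-∸-assoc 1 s≤1+n) ⟩
    stepSeq k n p (suc (suc n ∸ s))  ≤⟨ stepSeq-antitone countU≡n (suc n ∸ s) ⟩
    μ (suc s)                        ∎
    where open ≤-Reasoning

  μ-suc-≤ : IsDyck k n p → ∀ {s} → s ≤ n → μ (suc s) ≤ k * s
  μ-suc-≤ dyck {s} s≤n = begin
    μ (suc s)                        ≡⟨ cong (stepSeq k n p) (+-∸-assoc 1 s≤n) ⟩
    stepSeq k n p (suc (n ∸ s))      ≤⟨ stepSeq-suc-≤ dyck (n ∸ s) ⟩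
    k * (n ∸ (n ∸ s))                ≡⟨ cong (k *_) (m∸[m∸n]≡n s≤n) ⟩
    k * s                            ∎
    where open ≤-Reasoning

  xvec≡ : ∀ j r → xvec k n p j r ≡ + j ℤ.- + part k (suc (toℕ r)) (μ j)
  xvec≡ j r = cong (λ z → + j ℤ.- + z) (Mdec≡part k (stepSeq k n p) (suc (toℕ r)) ((2 + n) ∸ j))

  window⇒adjacent : ∀ {t j} → t ≤ j → μ j ≤ k * (j ∸ t) + μ t → k * (j ∸ t) + μ t ≤ k + μ j →
    Adjacent (xvec k n p t) (xvec k n p j)
  window⇒adjacent {t} {j} t≤j lo hi r rewrite xvec≡ t r | xvec≡ j r =
    ∣[t-a]-[j-b]∣≤1 t≤j part-lo part-hi
    where
    i = suc (toℕ r)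
    shift : part k i (k * (j ∸ t) + μ t) ≡ (j ∸ t) + part k i (μ t)
    shift = part-*-+ k i (s≤s z≤n) (toℕ<n r) (j ∸ t) (μ t)
    part-lo : part k i (μ j) ≤ (j ∸ t) + part k i (μ t)
    part-lo = ≤-trans (part-mono-≤ k i lo) (≤-reflexive shift)
    part-hi : (j ∸ t) + part k i (μ t) ≤ suc (part k i (μ j))
    part-hi = ≤-trans (≤-reflexive (sym shift))
                (≤-trans (part-mono-≤ k i hi) (≤-reflexive (part-+ k i (s≤s z≤n) (toℕ<n r) (μ j))))

  earlierNeighbours : IsDyck k n p → HasEarlierNeighbours k n p
  earlierNeighbours dyck@(countU≡n , _) (suc j) (s≤s 1≤j) (s≤s j≤n) =
    let t , 1≤t , t<j , lo , hi = window-crossing f (s≤s 1≤j) start end drop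
    in  t , 1≤t , t<j , window⇒adjacent (<⇒≤ t<j) lo hi
    where
    f : ℕ → ℕ
    f s = k * (suc j ∸ s) + μ s
    start : μ (suc j) ≤ f 1
    start = ≤-trans (μ-suc-≤ dyck j≤n) (m≤m+n (k * j) (μ 1))
    end : f (suc j) ≤ μ (suc j)
    end = ≤-reflexive (trans (cong (λ z → k * z + μ (suc j)) (n∸n≡0 j))
                             (cong (_+ μ (suc j)) (*-zeroʳ k)))
    drop : ∀ s → 1 ≤ s → s < suc j → f s ≤ k + f (suc s)
    drop s _ (s≤s s≤j) = begin
      k * (suc j ∸ s) + μ s          ≡⟨ cong (λ z → k * z + μ s) (+-∸-assoc 1 s≤j) ⟩
      k * suc (j ∸ s) + μ s          ≡⟨ cong (_+ μ s) (*-suc k (j ∸ s)) ⟩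
      k + k * (j ∸ s) + μ s          ≤⟨ +-monoʳ-≤ (k + k * (j ∸ s)) μs≤μ[1+s] ⟩
      k + k * (j ∸ s) + μ (suc s)    ≡⟨ +-assoc k (k * (j ∸ s)) (μ (suc s)) ⟩
      k + (k * (j ∸ s) + μ (suc s))  ∎
      where
      open ≤-Reasoning
      μs≤μ[1+s] : μ s ≤ μ (suc s)
      μs≤μ[1+s] = μ-mono-suc countU≡n (≤-trans s≤j (m≤n⇒m≤1+n j≤n))

last-below : ∀ {P : ℕ → Set} → Decidable P → ∀ {j i} → P j → j < i →
  ∃ λ w → j ≤ w × w < i × P w × (∀ w′ → w < w′ → w′ < i → ¬ P w′)
last-below P? {j} {suc i} Pj (s≤s j≤i) with P? i
... | yes Pi = i , j≤i , ≤-refl , Pi , λ w′ i<w′ w′<1+i → contradiction i<w′ (≤⇒≯ (≤-pred w′<1+i))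
... | no ¬Pi with m≤n⇒m<n∨m≡n j≤i
...   | inj₂ refl = contradiction Pj ¬Pi
...   | inj₁ j<i with last-below P? Pj j<i
...     | w , j≤w , w<i , Pw , last = w , j≤w , m<n⇒m<1+n w<i , Pw , last′
  where
  last′ : ∀ w′ → w < w′ → w′ < suc i → ¬ _
  last′ w′ w<w′ w′<1+i with m≤n⇒m<n∨m≡n (≤-pred w′<1+i)
  ... | inj₁ w′<i = last w′ w<w′ w′<i
  ... | inj₂ refl = ¬Pi

adjacent? : ∀ {k} (x y : Fin k → ℤ) → Dec (Adjacent x y)
adjacent? x y = all? (λ r → ℤ.∣ x r ℤ.- y r ∣ ≤? 1)

dirPath⇒uwalk : ∀ {k n p a b} vs → DirPath k n p a b vs → UWalk k n p a b vs
dirPath⇒uwalk (v ∷ [])     ends             = ends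
dirPath⇒uwalk (v ∷ w ∷ vs) (v≡a , e , rest) = v≡a , inj₁ e , dirPath⇒uwalk (w ∷ vs) rest

uwalk-++ : ∀ {k n p a b c} us {vs} →
  UWalk k n p a b (a ∷ us) → UWalk k n p b c (b ∷ vs) → UWalk k n p a c (a ∷ us ++ vs)
uwalk-++ []       (_ , refl)     b→c = b→c
uwalk-++ (u ∷ us) (_ , e , u→b)  b→c = refl , e , uwalk-++ us u→b b→c

uwalk-reverse : ∀ {k n p a b} us → UWalk k n p a b (a ∷ us) → ∃ λ vs → UWalk k n p b a (b ∷ vs)
uwalk-reverse []       (_ , refl)    = [] , refl , refl
uwalk-reverse {a = a} (u ∷ us) (_ , e , u→b) =
  let vs , b→u = uwalk-reverse us u→b
  in  vs ++ a ∷ [] , uwalk-++ vs b→u (refl , swap e , refl , refl)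

module Forest {k n p} (earlier : HasEarlierNeighbours k n p) where

  parent : ∀ i → 2 ≤ i → i ≤ suc n → ∃ (Edge k n p i)
  parent i 2≤i i≤1+n with earlier i 2≤i i≤1+n
  ... | t , 1≤t , t<i , adj
    with last-below (λ w → adjacent? (xvec k n p w) (xvec k n p i)) adj t<i
  ... | w , t≤w , w<i , adj-w , last = w , 2≤i , i≤1+n , ≤-trans 1≤t t≤w , w<i , adj-w , last

  parent-unique : ∀ {i w w′} → Edge k n p i w → Edge k n p i w′ → w ≡ w′
  parent-unique {w = w} {w′} (_ , _ , _ , w<i , adj , last) (_ , _ , _ , w′<i , adj′ , last′)
    with <-cmp w w′
  ... | tri< w<w′ _ _ = contradiction adj′ (last w′ w<w′ w′<i)
  ... | tri≈ _ w≡w′ _ = w≡w′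
  ... | tri> _ _ w′<w = contradiction adj (last′ w w′<w w<i)

  no-edge-from-root : ∀ j → ¬ Edge k n p 1 j
  no-edge-from-root j (s≤s () , _)

  pathToRoot : ∀ i → 1 ≤ i → i ≤ suc n → ∃ λ vs → DirPath k n p i 1 (i ∷ vs)
  pathToRoot i = go i (<-wellFounded i)
    where
    go : ∀ i → Acc _<_ i → 1 ≤ i → i ≤ suc n → ∃ λ vs → DirPath k n p i 1 (i ∷ vs)
    go 1                  _        _ _     = [] , refl , refl
    go i@(suc (suc _)) (acc below) _ i≤1+n with parent i (s≤s (s≤s z≤n)) i≤1+n
    ... | w , e@(_ , _ , 1≤w , w<i , _) with go w (below w<i) 1≤w (≤-trans (<⇒≤ w<i) i≤1+n)
    ... | vs , w→1 = w ∷ vs , refl , e , w→1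

  dirPathToRoot-unique : ∀ {a} vs ws → DirPath k n p a 1 vs → DirPath k n p a 1 ws → vs ≡ ws
  dirPathToRoot-unique (v ∷ [])     (_ ∷ [])      (refl , _)     (refl , _)     = refl
  dirPathToRoot-unique (v ∷ [])     (_ ∷ w′ ∷ _)  (refl , refl)  (refl , e′ , _) =
    contradiction e′ (no-edge-from-root w′)
  dirPathToRoot-unique (v ∷ w ∷ _)  (_ ∷ [])      (refl , e , _) (refl , refl)   =
    contradiction e (no-edge-from-root w)
  dirPathToRoot-unique (v ∷ w ∷ vs) (_ ∷ w′ ∷ ws) (refl , e , w→1) (refl , e′ , w′→1) =
    cong (v ∷_) (dirPathToRoot-unique (w ∷ vs) (w′ ∷ ws) w→1
      (subst (λ u → DirPath k n p u 1 (w′ ∷ ws)) (sym (parent-unique e e′)) w′→1))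

  connected : ∀ a b → 1 ≤ a → a ≤ suc n → 1 ≤ b → b ≤ suc n → ∃ λ vs → UWalk k n p a b vs
  connected a b 1≤a a≤1+n 1≤b b≤1+n =
    let us , a→1 = pathToRoot a 1≤a a≤1+n
        vs , b→1 = pathToRoot b 1≤b b≤1+n
        ws , 1→b = uwalk-reverse vs (dirPath⇒uwalk (b ∷ vs) b→1)
    in  a ∷ us ++ ws , uwalk-++ us (dirPath⇒uwalk (a ∷ us) a→1) 1→b

  uniquePathToRoot : ∀ i → 2 ≤ i → i ≤ suc n →
    ∃ λ vs → DirPath k n p i 1 vs × ((ws : List ℕ) → DirPath k n p i 1 ws → ws ≡ vs)
  uniquePathToRoot i 2≤i i≤1+n =
    let vs , i→1 = pathToRoot i (<⇒≤ 2≤i) i≤1+n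
    in  i ∷ vs , i→1 , λ ws i→1′ → dirPathToRoot-unique ws (i ∷ vs) i→1′ i→1

lemma5p22 : (k n : ℕ) → 1 ≤ k → 1 ≤ n → (p : List Step) → IsDyck k n p →
    -- 1. a single connected component
    ((a b : ℕ) → 1 ≤ a → a ≤ suc n → 1 ≤ b → b ≤ suc n →
      ∃ λ vs → UWalk k n p a b vs)
    -- 2. no outgoing edge from the root x_1
    × ((j : ℕ) → ¬ Edge k n p 1 j)
    -- 3. a unique directed path from x_i to x_1, for 2 ≤ i ≤ n+1
    × ((i : ℕ) → 2 ≤ i → i ≤ suc n →
      ∃ λ vs → DirPath k n p i 1 vs × ((ws : List ℕ) → DirPath k n p i 1 ws → ws ≡ vs))
lemma5p22 k n _ _ p dyck = connected , no-edge-from-root , uniquePathToRoot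
  where open Forest (Coordinates.earlierNeighbours k n p dyck)
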